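{- Let $p\geq 1$ and $n,k\ge 0$ be integers. The number of induced subgraphs of $\Gamma_n^p$ isomorphic to $Q_k$ is $$c_k(\Gamma_n^p)=\sum_{\substack{i_0,i_1,\ldots, i_{k} \geq 0\\ i_0+i_1+\dots+i_{k}=n-kp+p+1}} F_{i_0}^pF_{i_1}^p\cdots F_{i_{k}}^p.$$
   Context: For $p\geq 1$, a Fibonacci $p$-string of length $n$ is a binary string of length $n$ in which any two 1s are separated by at least $p$ 0s. The Fibonacci $p$-cube $\Gamma_n^p$ is the subgraph of the hypercube $Q_n$ (vertex set $\{0,1\}^n$, adjacency = differing in exactly one coordinate) induced by the Fibonacci $p$-strings of length $n$; $\Gamma_0^p=K_1$. $c_k(G)$ is the number of induced subgraphs of $G$ isomorphic to $Q_k$. The Fibonacci $p$-numbers are defined by $F_0^p=0$, $F_i^p=1$ for $i\in[1,p]$, and $F_n^p=F_{n-1}^p+F_{n-p-1}^p$ for $n\geq p+1$. An empty sum is $0$. -}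

module Defs where

open import Data.Nat using (ℕ; zero; suc; _+_; _*_; _∸_; _≤_; _<_; _≤?_)
open import Data.Nat.Properties using ()
open import Data.Bool using (Bool; true; false)
open import Data.Fin using (Fin; toℕ)
open import Data.Vec using (Vec; []; _∷_; lookup; toList)
open import Data.List using (List; []; _∷_; map; concatMap; upTo; length)
open import Data.Nat.ListAction using (sum; product)
open import Data.List.Membership.Propositional using (_∈_)
open import Data.List.Relation.Unary.Unique.Propositional using (Unique)
open import Data.Product using (Σ; _×_; _,_; proj₁)
open import Function.Bundles using (_⇔_)
open import Relation.Nullary using (yes; no)
open import Relation.Binary.PropositionalEquality using (_≡_)

-- Fibonacci p-numbers:  F_0 = 0,  F_i = 1 (1 ≤ i ≤ p),
-- F_n = F_{n-1} + F_{n-p-1} (n ≥ p+1).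
-- Implemented with a fuel argument (fuel ≥ index is maintained).

fibAux : ℕ → ℕ → ℕ → ℕ
fibAux p _        zero    = 0
fibAux p zero     (suc n) = 0   -- unreachable when fuel ≥ index
fibAux p (suc f)  (suc n) with suc n ≤? p
... | yes _ = 1
... | no  _ = fibAux p f n + fibAux p f (n ∸ p)   -- F_{n} + F_{(n+1)-p-1}

F : ℕ → ℕ → ℕ
F p n = fibAux p n n

compositions : (r : ℕ) → ℕ → List (Vec ℕ r)
compositions zero    zero    = [] ∷ []
compositions zero    (suc m) = []
compositions (suc r) m =
  concatMap (λ i → map (i ∷_) (compositions r (m ∸ i))) (upTo (suc m))

fibCompSum : (p k m : ℕ) → ℕ
fibCompSum p k m =
  sum (map (λ v → product (map (F p) (toList v))) (compositions (suc k) m))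

record Graph : Set₁ where
  field
    V   : Set
    Adj : V → V → Set
open Graph public

Induced : (G : Graph) → (V G → Set) → Graph
Induced G P = record { V = Σ (V G) P ; Adj = λ x y → Adj G (proj₁ x) (proj₁ y) }

_≅_ : Graph → Graph → Set
G ≅ H = Σ (V G → V H) λ f → Σ (V H → V G) λ g →
          (∀ x → g (f x) ≡ x) × (∀ y → f (g y) ≡ y) ×
          (∀ x y → Adj G x y ⇔ Adj H (f x) (f y))

hamming : {n : ℕ} → Vec Bool n → Vec Bool n → ℕ
hamming []       []       = 0
hamming (x ∷ xs) (y ∷ ys) with x Data.Bool.≟ y
... | yes _ = hamming xs ys
... | no  _ = suc (hamming xs ys)

Q : ℕ → Graph
Q n = record { V = Vec Bool n ; Adj = λ u v → hamming u v ≡ 1 }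

-- Fibonacci p-string: any two 1s (positions i < j) are separated by at least p 0s,
-- i.e. j - i - 1 ≥ p.
FibString : {n : ℕ} → ℕ → Vec Bool n → Set
FibString {n} p v = (i j : Fin n) → toℕ i < toℕ j →
  lookup v i ≡ true → lookup v j ≡ true → p + toℕ i < toℕ j

Γ : ℕ → ℕ → Graph
Γ p n = Induced (Q n) (FibString p)

-- Subsets of {0,1}^n, canonically represented as complete binary tries
-- (so that ≡ on representations is equality of subsets).

data VSet : ℕ → Set where
  leaf : Bool → VSet zero
  node : {n : ℕ} → VSet n → VSet n → VSet (suc n)   -- (first bit false , first bit true)

_∈ᵥ_ : {n : ℕ} → Vec Bool n → VSet n → Set
[]          ∈ᵥ leaf b   = b ≡ true
(false ∷ v) ∈ᵥ node l r = v ∈ᵥ l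
(true  ∷ v) ∈ᵥ node l r = v ∈ᵥ r

-- S is (the vertex set of) an induced subgraph of Γ_n^p isomorphic to Q_k:
-- S ⊆ V(Γ_n^p), and the subgraph induced by S (which is the same in Γ_n^p
-- and in Q_n, since Γ_n^p is itself induced) is isomorphic to Q_k.
InducedCubeOf : (p n k : ℕ) → VSet n → Set
InducedCubeOf p n k S =
  (∀ v → v ∈ᵥ S → FibString p v) × (Q k ≅ Induced (Q n) (λ v → v ∈ᵥ S))

HasExactly : {A : Set} → (A → Set) → ℕ → Set
HasExactly {A} P N = Σ (List A) λ L → Unique L × (∀ x → (x ∈ L) ⇔ P x) × length L ≡ N

-- Induced copies of Q k in Q n are exactly the k-dimensional subcubes, i.e. words over
-- {0, 1, ∗} with k stars. For an induced Q k, the first coordinate of the embedding is a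
-- Boolean function on Q k that changes along at most one edge at each vertex (two such edges
-- would give two vertices with the same image), so it is constant or a single coordinate up to
-- negation; either way both halves of the image are handled by induction on n.
--
-- A subcube lies in Γ p n iff its top vertex (stars read as 1) is a Fibonacci p-string, so one
-- counts Fibonacci words over {0, 1, ∗} with k stars. Reading them left to right gives a
-- recurrence in n which the (k+1)-fold convolution power of F also satisfies at n + p + 1 ∸ k * p,
-- because F (m + 1) = F m + F (m ∸ p) + [m = 0]; expanding that convolution power over weak
-- compositions gives the sum in the statement.

module Submission where

open import Defs
open import Data.Nat
  using (ℕ; zero; suc; pred; _+_; _*_; _∸_; _≤_; _<_; _≤?_; z≤n; s≤s; s≤s⁻¹; s<s; s<s⁻¹)
open import Data.Nat.Properties
  using (*-distribʳ-+; *-distribˡ-+; *-identityʳ; *-zeroʳ; +-comm; +-identityʳ; +-suc; +-∸-assoc;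
         0∸n≡0; <⇒≤; m+n∸n≡m; m∸n≤m; m≤m+n; m≤n⇒m<n∨m≡n; m≤n⇒m∸n≡0; n∸n≡0; n≤1+n; pred-mono-≤;
         suc-injective; ∸-+-assoc; ∸-mono; ≤-refl; ≤-reflexive; ≤-trans; ≰⇒>; +-commutativeSemigroup)
open import Data.Nat.ListAction using (sum; product)
open import Data.Nat.ListAction.Properties using (sum-++)
open import Data.List using (List; []; _∷_; map; concatMap; upTo; applyUpTo; length; _++_)
open import Data.List.Properties using (map-++; map-cong; map-∘; length-map; length-++)
open import Data.List.Membership.Propositional using (_∈_)
open import Data.List.Membership.Propositional.Properties
  using (∈-map⁺; ∈-map⁻; ∈-++⁺ˡ; ∈-++⁺ʳ; ∈-++⁻)
open import Data.List.Relation.Unary.Any using (here)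
open import Data.List.Relation.Unary.Unique.Propositional using (Unique)
open import Data.List.Relation.Unary.AllPairs using ([]; _∷_)
open import Data.List.Relation.Unary.All using (All; []; _∷_)
import Data.List.Relation.Unary.All as All using (map; lookup)
import Data.List.Relation.Unary.All.Properties as All using (map⁺; ++⁺)
import Data.List.Relation.Unary.Unique.Propositional.Properties as Unique
open import Data.List.Relation.Binary.Disjoint.Propositional using (Disjoint)
open import Data.Vec using (Vec; []; _∷_; head; tail; toList; lookup; replicate; updateAt; insertAt; removeAt)
open import Data.Vec.Properties
  using (∷-injectiveˡ; ∷-injectiveʳ; lookup∘updateAt; lookup∘updateAt′; updateAt-updateAt;
         updateAt-id-local; updateAt-commutes; lookup-replicate; insertAt-lookup; insertAt-removeAt)
open import Data.Bool using (Bool; true; false; not; _xor_) renaming (_≟_ to _≟ᵇ_)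
open import Data.Bool.Properties
  using (not-involutive; not-¬; ¬-not; xor-assoc; xor-comm; xor-same; xor-identityʳ; not-distribʳ-xor;
         ⇔→≡)
open import Data.Fin using (Fin; zero; suc; toℕ) renaming (_≟_ to _≟ᶠ_)
open import Data.Fin.Properties using (any?)
open import Data.Product using (Σ-syntax; _×_; _,_; proj₁; proj₂; uncurry)
import Data.Product as Product using (map₁)
open import Function.Bundles using (_⇔_; mk⇔; Equivalence)
open import Data.Sum using (_⊎_; inj₁; inj₂)
open import Data.Unit using (⊤; tt)
open import Data.Empty using (⊥)
open import Function using (_∘_)
open import Algebra.Properties.CommutativeSemigroup +-commutativeSemigroup
  using ()
  renaming (interchange to +-interchange; xy∙z≈xz∙y to +-right-comm; x∙yz≈xz∙y to +-rearrange)
open import Relation.Nullary using (yes; no; ¬_; contradiction)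
open import Relation.Nullary.Decidable using (decidable-stable)
open import Relation.Binary.PropositionalEquality
open ≡-Reasoning

-- Convolution powers and the Fibonacci p-numbers

δ : ℕ → ℕ
δ zero    = 1
δ (suc _) = 0

infixl 7 _⋆_

_⋆_ : (ℕ → ℕ) → (ℕ → ℕ) → ℕ → ℕ
(a ⋆ b) zero    = a 0 * b 0
(a ⋆ b) (suc m) = a 0 * b (suc m) + ((a ∘ suc) ⋆ b) m

⋆-congˡ : ∀ {a a′} b → (∀ i → a i ≡ a′ i) → ∀ m → (a ⋆ b) m ≡ (a′ ⋆ b) m
⋆-congˡ b eq zero    = cong (_* b 0) (eq 0)
⋆-congˡ b eq (suc m) = cong₂ _+_ (cong (_* b (suc m)) (eq 0)) (⋆-congˡ b (eq ∘ suc) m)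

⋆-distribʳ-+ : ∀ a a′ b m → ((λ i → a i + a′ i) ⋆ b) m ≡ (a ⋆ b) m + (a′ ⋆ b) m
⋆-distribʳ-+ a a′ b zero    = *-distribʳ-+ (b 0) (a 0) (a′ 0)
⋆-distribʳ-+ a a′ b (suc m) = begin
  (a 0 + a′ 0) * b (suc m) + ((λ i → a (suc i) + a′ (suc i)) ⋆ b) m
    ≡⟨ cong₂ _+_ (*-distribʳ-+ (b (suc m)) (a 0) (a′ 0)) (⋆-distribʳ-+ (a ∘ suc) (a′ ∘ suc) b m) ⟩
  (x + x′) + (y + y′)
    ≡⟨ +-interchange x x′ y y′ ⟩
  (x + y) + (x′ + y′) ∎
  where
  x  = a 0 * b (suc m)
  x′ = a′ 0 * b (suc m)
  y  = ((a ∘ suc) ⋆ b) m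
  y′ = ((a′ ∘ suc) ⋆ b) m

⋆-zeroˡ : ∀ b m → ((λ _ → 0) ⋆ b) m ≡ 0
⋆-zeroˡ b zero    = refl
⋆-zeroˡ b (suc m) = ⋆-zeroˡ b m

⋆-identityˡ : ∀ b m → (δ ⋆ b) m ≡ b m
⋆-identityˡ b zero    = +-identityʳ (b 0)
⋆-identityˡ b (suc m) =
  trans (cong (b (suc m) + 0 +_) (⋆-zeroˡ b m)) (trans (+-identityʳ _) (+-identityʳ _))

⋆-identityʳ : ∀ a m → (a ⋆ δ) m ≡ a m
⋆-identityʳ a zero    = *-identityʳ (a 0)
⋆-identityʳ a (suc m) = trans (cong (_+ ((a ∘ suc) ⋆ δ) m) (*-zeroʳ (a 0))) (⋆-identityʳ (a ∘ suc) m)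

⋆-shift : ∀ q a b m → a 0 ≡ 0 → ((λ i → a (i ∸ q)) ⋆ b) m ≡ (a ⋆ b) (m ∸ q)
⋆-shift zero    a b m       _  = refl
⋆-shift (suc q) a b zero    _  = refl
⋆-shift (suc q) a b (suc m) a₀ =
  trans (cong (λ x → x * b (suc m) + ((λ i → a (i ∸ q)) ⋆ b) m) a₀) (⋆-shift q a b m a₀)

⋆-recurrence : ∀ p a b → a 0 ≡ 0 → (∀ m → a (suc m) ≡ a m + a (m ∸ p) + δ m) →
               ∀ m → (a ⋆ b) (suc m) ≡ (a ⋆ b) m + b m + (a ⋆ b) (m ∸ p)
⋆-recurrence p a b a₀ a-suc m = begin
  a 0 * b (suc m) + ((a ∘ suc) ⋆ b) m
    ≡⟨ cong (λ x → x * b (suc m) + ((a ∘ suc) ⋆ b) m) a₀ ⟩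
  ((a ∘ suc) ⋆ b) m
    ≡⟨ ⋆-congˡ b a-suc m ⟩
  ((λ i → a i + a (i ∸ p) + δ i) ⋆ b) m
    ≡⟨ ⋆-distribʳ-+ (λ i → a i + a (i ∸ p)) δ b m ⟩
  ((λ i → a i + a (i ∸ p)) ⋆ b) m + (δ ⋆ b) m
    ≡⟨ cong₂ _+_ (⋆-distribʳ-+ a (λ i → a (i ∸ p)) b m) (⋆-identityˡ b m) ⟩
  (a ⋆ b) m + ((λ i → a (i ∸ p)) ⋆ b) m + b m
    ≡⟨ cong (λ x → (a ⋆ b) m + x + b m) (⋆-shift p a b m a₀) ⟩
  (a ⋆ b) m + (a ⋆ b) (m ∸ p) + b m
    ≡⟨ +-right-comm ((a ⋆ b) m) _ (b m) ⟩
  (a ⋆ b) m + b m + (a ⋆ b) (m ∸ p) ∎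

infixr 8 _⋆^_

_⋆^_ : (ℕ → ℕ) → ℕ → ℕ → ℕ
a ⋆^ zero  = δ
a ⋆^ suc r = a ⋆ (a ⋆^ r)

map-applyUpTo : ∀ {A B : Set} (g : A → B) f n → map g (applyUpTo f n) ≡ applyUpTo (g ∘ f) n
map-applyUpTo g f zero    = refl
map-applyUpTo g f (suc n) = cong (g (f 0) ∷_) (map-applyUpTo g (f ∘ suc) n)

⋆-as-sum : ∀ a b m → (a ⋆ b) m ≡ sum (map (λ i → a i * b (m ∸ i)) (upTo (suc m)))
⋆-as-sum a b zero    = sym (+-identityʳ (a 0 * b 0))
⋆-as-sum a b (suc m) = cong (a 0 * b (suc m) +_) (begin
  ((a ∘ suc) ⋆ b) m
    ≡⟨ ⋆-as-sum (a ∘ suc) b m ⟩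
  sum (map (λ i → a (suc i) * b (m ∸ i)) (upTo (suc m)))
    ≡⟨ cong sum (map-applyUpTo _ (λ i → i) (suc m)) ⟩
  sum (applyUpTo (λ i → a (suc i) * b (m ∸ i)) (suc m))
    ≡⟨ cong sum (map-applyUpTo _ suc (suc m)) ⟨
  sum (map (λ i → a i * b (suc m ∸ i)) (applyUpTo suc (suc m))) ∎)

sum-map-concatMap : ∀ {A B : Set} (g : B → ℕ) (h : A → List B) xs →
                    sum (map g (concatMap h xs)) ≡ sum (map (λ x → sum (map g (h x))) xs)
sum-map-concatMap g h []       = refl
sum-map-concatMap g h (x ∷ xs) = begin
  sum (map g (h x ++ concatMap h xs))
    ≡⟨ cong sum (map-++ g (h x) (concatMap h xs)) ⟩
  sum (map g (h x) ++ map g (concatMap h xs))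
    ≡⟨ sum-++ (map g (h x)) _ ⟩
  sum (map g (h x)) + sum (map g (concatMap h xs))
    ≡⟨ cong (sum (map g (h x)) +_) (sum-map-concatMap g h xs) ⟩
  sum (map g (h x)) + sum (map (λ x → sum (map g (h x))) xs) ∎

sum-map-*ˡ : ∀ {A : Set} c (g : A → ℕ) xs → sum (map (λ x → c * g x) xs) ≡ c * sum (map g xs)
sum-map-*ˡ c g []       = sym (*-zeroʳ c)
sum-map-*ˡ c g (x ∷ xs) = trans (cong (c * g x +_) (sum-map-*ˡ c g xs)) (sym (*-distribˡ-+ c (g x) _))

compositions-⋆^ : ∀ f r m →
                  sum (map (λ v → product (map f (toList v))) (compositions r m)) ≡ (f ⋆^ r) m
compositions-⋆^ f zero    zero    = refl
compositions-⋆^ f zero    (suc m) = refl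
compositions-⋆^ f (suc r) m = begin
  sum (map ∏f (concatMap (λ i → map (i ∷_) (compositions r (m ∸ i))) (upTo (suc m))))
    ≡⟨ sum-map-concatMap ∏f (λ i → map (i ∷_) (compositions r (m ∸ i))) (upTo (suc m)) ⟩
  sum (map (λ i → sum (map ∏f (map (i ∷_) (compositions r (m ∸ i))))) (upTo (suc m)))
    ≡⟨ cong sum (map-cong first-factor (upTo (suc m))) ⟩
  sum (map (λ i → f i * (f ⋆^ r) (m ∸ i)) (upTo (suc m)))
    ≡⟨ ⋆-as-sum f (f ⋆^ r) m ⟨
  (f ⋆^ suc r) m ∎
  where
  ∏f : ∀ {n} → Vec ℕ n → ℕ
  ∏f v = product (map f (toList v))
  first-factor : ∀ i → sum (map ∏f (map (i ∷_) (compositions r (m ∸ i)))) ≡ f i * (f ⋆^ r) (m ∸ i)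
  first-factor i = begin
    sum (map ∏f (map (i ∷_) (compositions r (m ∸ i))))
      ≡⟨ cong sum (map-∘ (compositions r (m ∸ i))) ⟨
    sum (map (λ v → f i * ∏f v) (compositions r (m ∸ i)))
      ≡⟨ sum-map-*ˡ (f i) ∏f (compositions r (m ∸ i)) ⟩
    f i * sum (map ∏f (compositions r (m ∸ i)))
      ≡⟨ cong (f i *_) (compositions-⋆^ f r (m ∸ i)) ⟩
    f i * (f ⋆^ r) (m ∸ i) ∎

fibAux-fuel : ∀ p f g i → i ≤ f → i ≤ g → fibAux p f i ≡ fibAux p g i
fibAux-fuel p f       g       zero    _         _         = refl
fibAux-fuel p (suc f) (suc g) (suc i) (s≤s i≤f) (s≤s i≤g) with suc i ≤? p
... | yes _ = refl
... | no  _ = cong₂ _+_ (fibAux-fuel p f g i i≤f i≤g)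
                        (fibAux-fuel p f g (i ∸ p) (≤-trans (m∸n≤m i p) i≤f)
                                                   (≤-trans (m∸n≤m i p) i≤g))

F-small : ∀ p m → suc m ≤ p → F p (suc m) ≡ 1
F-small p m m<p with suc m ≤? p
... | yes _   = refl
... | no  m≮p = contradiction m<p m≮p

-- The δ term supplies F 1 = 1, and truncated subtraction (m ∸ p = 0 for m ≤ p) keeps the
-- recurrence valid on the initial values F 2 = … = F (p + 1) = 1.
F-suc : ∀ {p} → 1 ≤ p → ∀ m → F p (suc m) ≡ F p m + F p (m ∸ p) + δ m
F-suc {p} 1≤p m with suc m ≤? p
F-suc {p} 1≤p zero    | yes _   = cong (λ i → F p i + 1) (sym (0∸n≡0 p))
F-suc {p} 1≤p (suc m) | yes 2+m≤p =
  sym (cong₂ (λ x i → x + F p i + 0) (F-small p m (<⇒≤ 2+m≤p)) (m≤n⇒m∸n≡0 (<⇒≤ 2+m≤p)))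
F-suc {p} 1≤p zero    | no  m≮p = contradiction 1≤p m≮p
F-suc {p} 1≤p (suc m) | no  m≮p =
  sym (trans (+-identityʳ _) (cong (F p (suc m) +_)
    (fibAux-fuel p (suc m ∸ p) (suc m) (suc m ∸ p) ≤-refl (m∸n≤m (suc m) p))))

F-initial : ∀ {p} → 1 ≤ p → ∀ j → j ≤ p → F p (suc j) ≡ 1
F-initial {p} 1≤p j j≤p with m≤n⇒m<n∨m≡n j≤p
... | inj₁ j<p  = F-small p j j<p
F-initial {suc q} 1≤p _ _ | inj₂ refl = begin
  F (suc q) (suc (suc q))                             ≡⟨ F-suc 1≤p (suc q) ⟩
  F (suc q) (suc q) + F (suc q) (suc q ∸ suc q) + 0
    ≡⟨ cong₂ (λ x i → x + F (suc q) i + 0) (F-small (suc q) q ≤-refl) (n∸n≡0 q) ⟩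
  1 + F (suc q) 0 + 0                                 ∎

-- The hypercube

toggle : ∀ {k} → Fin k → Vec Bool k → Vec Bool k
toggle i u = updateAt u i not

toggle-involutive : ∀ {k} (i : Fin k) u → toggle i (toggle i u) ≡ u
toggle-involutive i u = trans (updateAt-updateAt i u) (updateAt-id-local i u (not-involutive _))

toggle-comm : ∀ {k} {i j : Fin k} → i ≢ j → ∀ u → toggle i (toggle j u) ≡ toggle j (toggle i u)
toggle-comm {i = i} {j} i≢j u = updateAt-commutes i j i≢j u

toggle-injectiveˡ : ∀ {k} {i j : Fin k} u → toggle i u ≡ toggle j u → i ≡ j
toggle-injectiveˡ {i = i} {j} u eq with i ≟ᶠ j
... | yes i≡j = i≡j
... | no  i≢j = contradiction (begin
  not (lookup u i)         ≡⟨ lookup∘updateAt i u ⟨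
  lookup (toggle i u) i    ≡⟨ cong (λ v → lookup v i) eq ⟩
  lookup (toggle j u) i    ≡⟨ lookup∘updateAt′ i j i≢j u ⟩
  lookup u i               ∎) (not-¬ refl ∘ sym)

toggle-induction : ∀ {k} (P : Vec Bool k → Set) → P (replicate k false) →
                   (∀ j u → P u → P (toggle j u)) → ∀ u → P u
toggle-induction {zero}  P P₀ step []          = P₀
toggle-induction {suc k} P P₀ step (false ∷ u) =
  toggle-induction (P ∘ (false ∷_)) P₀ (λ j u → step (suc j) (false ∷ u)) u
toggle-induction {suc k} P P₀ step (true ∷ u)  =
  step zero (false ∷ u) (toggle-induction (P ∘ (false ∷_)) P₀ (λ j u → step (suc j) (false ∷ u)) u)

hamming-∷ : ∀ {n} b (x y : Vec Bool n) → hamming (b ∷ x) (b ∷ y) ≡ hamming x y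
hamming-∷ false x y = refl
hamming-∷ true  x y = refl

hamming-∷-≢ : ∀ {n} {b b′} → b ≢ b′ → (x y : Vec Bool n) →
              hamming (b ∷ x) (b′ ∷ y) ≡ suc (hamming x y)
hamming-∷-≢ {b = false} {false} b≢b′ x y = contradiction refl b≢b′
hamming-∷-≢ {b = false} {true}  b≢b′ x y = refl
hamming-∷-≢ {b = true}  {false} b≢b′ x y = refl
hamming-∷-≢ {b = true}  {true}  b≢b′ x y = contradiction refl b≢b′

hamming-self : ∀ {n} (u : Vec Bool n) → hamming u u ≡ 0
hamming-self []      = refl
hamming-self (b ∷ u) = trans (hamming-∷ b u u) (hamming-self u)

hamming≡0⇒≡ : ∀ {n} (u v : Vec Bool n) → hamming u v ≡ 0 → u ≡ v
hamming≡0⇒≡ []          []          _  = refl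
hamming≡0⇒≡ (false ∷ u) (false ∷ v) eq = cong (false ∷_) (hamming≡0⇒≡ u v eq)
hamming≡0⇒≡ (true ∷ u)  (true ∷ v)  eq = cong (true ∷_) (hamming≡0⇒≡ u v eq)

hamming-toggle : ∀ {k} (u : Vec Bool k) i → hamming u (toggle i u) ≡ 1
hamming-toggle (false ∷ u) zero    = cong suc (hamming-self u)
hamming-toggle (true ∷ u)  zero    = cong suc (hamming-self u)
hamming-toggle (b ∷ u)     (suc i) = trans (hamming-∷ b u (toggle i u)) (hamming-toggle u i)

hamming-insertAt : ∀ {k} (u v : Vec Bool k) i b → hamming (insertAt u i b) (insertAt v i b) ≡ hamming u v
hamming-insertAt u           v           zero    b = hamming-∷ b u v
hamming-insertAt (false ∷ u) (false ∷ v) (suc i) b = hamming-insertAt u v i b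
hamming-insertAt (false ∷ u) (true ∷ v)  (suc i) b = cong suc (hamming-insertAt u v i b)
hamming-insertAt (true ∷ u)  (false ∷ v) (suc i) b = cong suc (hamming-insertAt u v i b)
hamming-insertAt (true ∷ u)  (true ∷ v)  (suc i) b = hamming-insertAt u v i b

AtMostOneSwitch : ∀ {k} → (Vec Bool k → Bool) → Set
AtMostOneSwitch h = ∀ u i j → h (toggle i u) ≢ h u → h (toggle j u) ≢ h u → i ≡ j

module _ {k} {h : Vec Bool k → Bool} (one : AtMostOneSwitch h) where

  private
    0⃗ : Vec Bool k
    0⃗ = replicate k false

    switch : Fin k → Vec Bool k → Bool
    switch i u = h (toggle i u) xor h u

    h-toggle : ∀ i u → h (toggle i u) ≡ switch i u xor h u
    h-toggle i u = sym (trans (xor-assoc (h (toggle i u)) (h u) (h u))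
                              (trans (cong (h (toggle i u) xor_) (xor-same (h u))) (xor-identityʳ _)))

    switch⇔ : ∀ {i u} → switch i u ≡ true ⇔ h (toggle i u) ≢ h u
    switch⇔ {i} {u} with h (toggle i u) | h u
    ... | true  | true  = mk⇔ (λ ()) (λ ne → contradiction refl ne)
    ... | true  | false = mk⇔ (λ _ ()) (λ _ → refl)
    ... | false | true  = mk⇔ (λ _ ()) (λ _ → refl)
    ... | false | false = mk⇔ (λ ()) (λ ne → contradiction refl ne)

    switch⇒≢ : ∀ {i u} → switch i u ≡ true → h (toggle i u) ≢ h u
    switch⇒≢ = Equivalence.to switch⇔

    ≢⇒switch : ∀ {i u} → h (toggle i u) ≢ h u → switch i u ≡ true
    ≢⇒switch = Equivalence.from switch⇔

    switch-false : ∀ {i u} → switch i u ≢ true → h (toggle i u) ≡ h u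
    switch-false {i} {u} ¬sw = decidable-stable (h (toggle i u) ≟ᵇ h u) (¬sw ∘ ≢⇒switch)

    no-second-switch : ∀ {i j u} → i ≢ j → h (toggle i u) ≢ h u → h (toggle j u) ≡ h u
    no-second-switch {i} {j} {u} i≢j sw =
      decidable-stable (h (toggle j u) ≟ᵇ h u) (i≢j ∘ one u i j sw)

    -- In a square u, toggle i u, toggle j u, toggle i (toggle j u), a switch along one
    -- i-edge forbids switches along both j-edges, which forces a switch along the other i-edge.
    square : ∀ {i j} → i ≢ j → ∀ u →
             h (toggle i u) ≢ h u → h (toggle i (toggle j u)) ≢ h (toggle j u)
    square {i} {j} i≢j u sw eq = sw (begin
      h (toggle i u)                        ≡⟨ no-second-switch i≢j back ⟨
      h (toggle j (toggle i u))             ≡⟨ cong h (toggle-comm i≢j u) ⟨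
      h (toggle i (toggle j u))             ≡⟨ eq ⟩
      h (toggle j u)                        ≡⟨ no-second-switch i≢j sw ⟩
      h u                                   ∎)
      where
      back : h (toggle i (toggle i u)) ≢ h (toggle i u)
      back = sw ∘ sym ∘ trans (cong h (sym (toggle-involutive i u)))

    switch-toggle : ∀ i j u → switch i (toggle j u) ≡ switch i u
    switch-toggle i j u with i ≟ᶠ j
    ... | yes refl = trans (cong (λ v → h v xor h (toggle i u)) (toggle-involutive i u)) (xor-comm (h u) _)
    ... | no  i≢j  = ⇔→≡ (mk⇔ (≢⇒switch ∘ back ∘ square i≢j (toggle j u) ∘ switch⇒≢)
                               (≢⇒switch ∘ square i≢j u ∘ switch⇒≢))
      where
      back : h (toggle i (toggle j (toggle j u))) ≢ h (toggle j (toggle j u)) → h (toggle i u) ≢ h u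
      back = subst (λ v → h (toggle i v) ≢ h v) (toggle-involutive j u)

    switch-constant : ∀ i u → switch i u ≡ switch i 0⃗
    switch-constant i = toggle-induction (λ u → switch i u ≡ switch i 0⃗) refl
                          (λ j u eq → trans (switch-toggle i j u) eq)

  constant-or-dictator : (∀ u → h u ≡ h (replicate k false)) ⊎
                         Σ[ c ∈ Fin k ] (∀ u → h u ≡ h (replicate k false) xor lookup u c)
  constant-or-dictator with any? (λ i → switch i 0⃗ ≟ᵇ true)
  ... | no  none    =
    inj₁ (toggle-induction (λ u → h u ≡ h 0⃗) refl (λ j u eq → trans (no-switch j u) eq))
    where
    no-switch : ∀ j u → h (toggle j u) ≡ h u
    no-switch j u = switch-false (λ sw → none (j , trans (sym (switch-constant j u)) sw))
  ... | yes (c , sw) = inj₂ (c , toggle-induction P base step)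
    where
    P : Vec Bool k → Set
    P u = h u ≡ h 0⃗ xor lookup u c
    base : P 0⃗
    base = sym (trans (cong (h 0⃗ xor_) (lookup-replicate c false)) (xor-identityʳ _))
    step : ∀ j u → P u → P (toggle j u)
    step j u Pu with j ≟ᶠ c
    ... | yes refl = begin
      h (toggle c u)                  ≡⟨ h-toggle c u ⟩
      switch c u xor h u              ≡⟨ cong (_xor h u) (trans (switch-constant c u) sw) ⟩
      not (h u)                       ≡⟨ cong not Pu ⟩
      not (h 0⃗ xor lookup u c)        ≡⟨ not-distribʳ-xor (h 0⃗) (lookup u c) ⟩
      h 0⃗ xor not (lookup u c)        ≡⟨ cong (h 0⃗ xor_) (lookup∘updateAt c u) ⟨
      h 0⃗ xor lookup (toggle c u) c   ∎
    ... | no  j≢c  = begin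
      h (toggle j u)                  ≡⟨ switch-false no-switchⱼ ⟩
      h u                             ≡⟨ Pu ⟩
      h 0⃗ xor lookup u c              ≡⟨ cong (h 0⃗ xor_) (lookup∘updateAt′ c j (j≢c ∘ sym) u) ⟨
      h 0⃗ xor lookup (toggle j u) c   ∎
      where
      no-switchⱼ : switch j u ≢ true
      no-switchⱼ swⱼ = j≢c (one 0⃗ j c (switch⇒≢ (trans (sym (switch-constant j u)) swⱼ)) (switch⇒≢ sw))

-- Vertex sets and subcubes

∅ : ∀ n → VSet n
∅ zero    = leaf false
∅ (suc n) = node (∅ n) (∅ n)

∉∅ : ∀ {n} (v : Vec Bool n) → ¬ v ∈ᵥ ∅ n
∉∅ []          ()
∉∅ (false ∷ v) = ∉∅ v
∉∅ (true ∷ v)  = ∉∅ v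

∈ᵥ-irrelevant : ∀ {n} (v : Vec Bool n) S (p q : v ∈ᵥ S) → p ≡ q
∈ᵥ-irrelevant []          (leaf _)   refl refl = refl
∈ᵥ-irrelevant (false ∷ v) (node l r) p    q    = ∈ᵥ-irrelevant v l p q
∈ᵥ-irrelevant (true ∷ v)  (node l r) p    q    = ∈ᵥ-irrelevant v r p q

∈ᵥ-Σ-≡ : ∀ {n} {S : VSet n} {v v′} {v∈ : v ∈ᵥ S} {v′∈ : v′ ∈ᵥ S} → v ≡ v′ →
          _≡_ {A = Σ[ x ∈ Vec Bool n ] x ∈ᵥ S} (v , v∈) (v′ , v′∈)
∈ᵥ-Σ-≡ {S = S} {v} refl = cong (v ,_) (∈ᵥ-irrelevant v S _ _)

VSet-ext : ∀ {n} (S S′ : VSet n) → (∀ v → v ∈ᵥ S → v ∈ᵥ S′) → (∀ v → v ∈ᵥ S′ → v ∈ᵥ S) →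
           S ≡ S′
VSet-ext (leaf false) (leaf false) _ _ = refl
VSet-ext (leaf false) (leaf true)  _ ⊇ with () ← ⊇ [] refl
VSet-ext (leaf true)  (leaf false) ⊆ _ with () ← ⊆ [] refl
VSet-ext (leaf true)  (leaf true)  _ _ = refl
VSet-ext (node l r) (node l′ r′) ⊆ ⊇ =
  cong₂ node (VSet-ext l l′ (⊆ ∘ (false ∷_)) (⊇ ∘ (false ∷_)))
             (VSet-ext r r′ (⊆ ∘ (true ∷_)) (⊇ ∘ (true ∷_)))

empty⇒≡∅ : ∀ {n} (S : VSet n) → (∀ v → ¬ v ∈ᵥ S) → S ≡ ∅ n
empty⇒≡∅ S none =
  VSet-ext S (∅ _) (λ v v∈S → contradiction v∈S (none v)) (λ v v∈∅ → contradiction v∈∅ (∉∅ v))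

half : ∀ {n} → VSet (suc n) → Bool → VSet n
half (node l r) false = l
half (node l r) true  = r

∈-half⁺ : ∀ {n} (S : VSet (suc n)) b (v : Vec Bool n) → v ∈ᵥ half S b → (b ∷ v) ∈ᵥ S
∈-half⁺ (node l r) false v v∈ = v∈
∈-half⁺ (node l r) true  v v∈ = v∈

∈-half⁻ : ∀ {n} (S : VSet (suc n)) b (v : Vec Bool n) → (b ∷ v) ∈ᵥ S → v ∈ᵥ half S b
∈-half⁻ (node l r) false v v∈ = v∈
∈-half⁻ (node l r) true  v v∈ = v∈

data Coord : Set where
  fix0 fix1 free : Coord

Subcube : ℕ → Set
Subcube = Vec Coord

dim : ∀ {n} → Subcube n → ℕ
dim []         = 0
dim (fix0 ∷ w) = dim w
dim (fix1 ∷ w) = dim w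
dim (free ∷ w) = suc (dim w)

cubeSet : ∀ {n} → Subcube n → VSet n
cubeSet []         = leaf true
cubeSet (fix0 ∷ w) = node (cubeSet w) (∅ _)
cubeSet (fix1 ∷ w) = node (∅ _) (cubeSet w)
cubeSet (free ∷ w) = node (cubeSet w) (cubeSet w)

vertex : ∀ {n} (w : Subcube n) → Vec Bool (dim w) → Vec Bool n
vertex []         u       = []
vertex (fix0 ∷ w) u       = false ∷ vertex w u
vertex (fix1 ∷ w) u       = true ∷ vertex w u
vertex (free ∷ w) (b ∷ u) = b ∷ vertex w u

vertex-∈ : ∀ {n} (w : Subcube n) u → vertex w u ∈ᵥ cubeSet w
vertex-∈ []         []          = refl
vertex-∈ (fix0 ∷ w) u           = vertex-∈ w u
vertex-∈ (fix1 ∷ w) u           = vertex-∈ w u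
vertex-∈ (free ∷ w) (false ∷ u) = vertex-∈ w u
vertex-∈ (free ∷ w) (true ∷ u)  = vertex-∈ w u

coords : ∀ {n} (w : Subcube n) v → v ∈ᵥ cubeSet w → Vec Bool (dim w)
coords []         []          _  = []
coords (fix0 ∷ w) (false ∷ v) v∈ = coords w v v∈
coords (fix0 ∷ w) (true ∷ v)  v∈ = contradiction v∈ (∉∅ v)
coords (fix1 ∷ w) (false ∷ v) v∈ = contradiction v∈ (∉∅ v)
coords (fix1 ∷ w) (true ∷ v)  v∈ = coords w v v∈
coords (free ∷ w) (false ∷ v) v∈ = false ∷ coords w v v∈
coords (free ∷ w) (true ∷ v)  v∈ = true ∷ coords w v v∈

coords-vertex : ∀ {n} (w : Subcube n) u v∈ → coords w (vertex w u) v∈ ≡ u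
coords-vertex []         []          _  = refl
coords-vertex (fix0 ∷ w) u           v∈ = coords-vertex w u v∈
coords-vertex (fix1 ∷ w) u           v∈ = coords-vertex w u v∈
coords-vertex (free ∷ w) (false ∷ u) v∈ = cong (false ∷_) (coords-vertex w u v∈)
coords-vertex (free ∷ w) (true ∷ u)  v∈ = cong (true ∷_) (coords-vertex w u v∈)

vertex-coords : ∀ {n} (w : Subcube n) v v∈ → vertex w (coords w v v∈) ≡ v
vertex-coords []         []          _  = refl
vertex-coords (fix0 ∷ w) (false ∷ v) v∈ = cong (false ∷_) (vertex-coords w v v∈)
vertex-coords (fix0 ∷ w) (true ∷ v)  v∈ = contradiction v∈ (∉∅ v)
vertex-coords (fix1 ∷ w) (false ∷ v) v∈ = contradiction v∈ (∉∅ v)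
vertex-coords (fix1 ∷ w) (true ∷ v)  v∈ = cong (true ∷_) (vertex-coords w v v∈)
vertex-coords (free ∷ w) (false ∷ v) v∈ = cong (false ∷_) (vertex-coords w v v∈)
vertex-coords (free ∷ w) (true ∷ v)  v∈ = cong (true ∷_) (vertex-coords w v v∈)

hamming-vertex : ∀ {n} (w : Subcube n) u u′ → hamming (vertex w u) (vertex w u′) ≡ hamming u u′
hamming-vertex []         []          []           = refl
hamming-vertex (fix0 ∷ w) u           u′           = hamming-vertex w u u′
hamming-vertex (fix1 ∷ w) u           u′           = hamming-vertex w u u′
hamming-vertex (free ∷ w) (false ∷ u) (false ∷ u′) = hamming-vertex w u u′
hamming-vertex (free ∷ w) (false ∷ u) (true ∷ u′)  = cong suc (hamming-vertex w u u′)
hamming-vertex (free ∷ w) (true ∷ u)  (false ∷ u′) = cong suc (hamming-vertex w u u′)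
hamming-vertex (free ∷ w) (true ∷ u)  (true ∷ u′)  = hamming-vertex w u u′

Q≅cubeSet : ∀ {n} (w : Subcube n) → Q (dim w) ≅ Induced (Q n) (_∈ᵥ cubeSet w)
Q≅cubeSet w =
  (λ u → vertex w u , vertex-∈ w u) ,
  (λ (v , v∈) → coords w v v∈) ,
  (λ u → coords-vertex w u (vertex-∈ w u)) ,
  (λ (v , v∈) → ∈ᵥ-Σ-≡ (vertex-coords w v v∈)) ,
  (λ u u′ → mk⇔ (trans (hamming-vertex w u u′)) (trans (sym (hamming-vertex w u u′))))

-- Fibonacci strings are closed under turning 1s into 0s, so a subcube lies in Γ p n iff its
-- top vertex does.
top : ∀ {n} → Subcube n → Vec Bool n
top []         = []
top (fix0 ∷ w) = false ∷ top w
top (fix1 ∷ w) = true ∷ top w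
top (free ∷ w) = true ∷ top w

top-∈ : ∀ {n} (w : Subcube n) → top w ∈ᵥ cubeSet w
top-∈ []         = refl
top-∈ (fix0 ∷ w) = top-∈ w
top-∈ (fix1 ∷ w) = top-∈ w
top-∈ (free ∷ w) = top-∈ w

∈cubeSet⇒≤top : ∀ {n} (w : Subcube n) v → v ∈ᵥ cubeSet w →
                ∀ i → lookup v i ≡ true → lookup (top w) i ≡ true
∈cubeSet⇒≤top (fix0 ∷ w) (true ∷ v)  v∈ _       _  = contradiction v∈ (∉∅ v)
∈cubeSet⇒≤top (fix1 ∷ w) (false ∷ v) v∈ _       _  = contradiction v∈ (∉∅ v)
∈cubeSet⇒≤top (fix0 ∷ w) (false ∷ v) v∈ (suc i) vᵢ = ∈cubeSet⇒≤top w v v∈ i vᵢ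
∈cubeSet⇒≤top (fix1 ∷ w) (true ∷ v)  v∈ zero    _  = refl
∈cubeSet⇒≤top (fix1 ∷ w) (true ∷ v)  v∈ (suc i) vᵢ = ∈cubeSet⇒≤top w v v∈ i vᵢ
∈cubeSet⇒≤top (free ∷ w) (b ∷ v)     v∈ zero    _  = refl
∈cubeSet⇒≤top (free ∷ w) (false ∷ v) v∈ (suc i) vᵢ = ∈cubeSet⇒≤top w v v∈ i vᵢ
∈cubeSet⇒≤top (free ∷ w) (true ∷ v)  v∈ (suc i) vᵢ = ∈cubeSet⇒≤top w v v∈ i vᵢ

cubeSet-nonempty : ∀ {n} (w : Subcube n) → cubeSet w ≢ ∅ n
cubeSet-nonempty w eq = ∉∅ (top w) (subst (top w ∈ᵥ_) eq (top-∈ w))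

node-injectiveˡ : ∀ {n} {l r l′ r′ : VSet n} → node l r ≡ node l′ r′ → l ≡ l′
node-injectiveˡ refl = refl

node-injectiveʳ : ∀ {n} {l r l′ r′ : VSet n} → node l r ≡ node l′ r′ → r ≡ r′
node-injectiveʳ refl = refl

cubeSet-injective : ∀ {n} (w w′ : Subcube n) → cubeSet w ≡ cubeSet w′ → w ≡ w′
cubeSet-injective []         []          _  = refl
cubeSet-injective (fix0 ∷ w) (fix0 ∷ w′) eq = cong (fix0 ∷_) (cubeSet-injective w w′ (node-injectiveˡ eq))
cubeSet-injective (fix1 ∷ w) (fix1 ∷ w′) eq = cong (fix1 ∷_) (cubeSet-injective w w′ (node-injectiveʳ eq))
cubeSet-injective (free ∷ w) (free ∷ w′) eq = cong (free ∷_) (cubeSet-injective w w′ (node-injectiveˡ eq))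
cubeSet-injective (fix0 ∷ w) (fix1 ∷ w′) eq = contradiction (node-injectiveˡ eq) (cubeSet-nonempty w)
cubeSet-injective (fix0 ∷ w) (free ∷ w′) eq = contradiction (sym (node-injectiveʳ eq)) (cubeSet-nonempty w′)
cubeSet-injective (fix1 ∷ w) (fix0 ∷ w′) eq = contradiction (node-injectiveʳ eq) (cubeSet-nonempty w)
cubeSet-injective (fix1 ∷ w) (free ∷ w′) eq = contradiction (sym (node-injectiveˡ eq)) (cubeSet-nonempty w′)
cubeSet-injective (free ∷ w) (fix0 ∷ w′) eq = contradiction (node-injectiveʳ eq) (cubeSet-nonempty w)
cubeSet-injective (free ∷ w) (fix1 ∷ w′) eq = contradiction (node-injectiveˡ eq) (cubeSet-nonempty w)

-- Images of cubes are subcubes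

≡head∷tail : ∀ {A : Set} {n} (x : Vec A (suc n)) → x ≡ head x ∷ tail x
≡head∷tail (a ∷ x) = refl

Vec₀-unique : ∀ {A : Set} (x y : Vec A 0) → x ≡ y
Vec₀-unique [] [] = refl

-- Weaker than an isomorphism onto the induced subgraph: adjacency need only be preserved.
record CubeImage (k : ℕ) {n} (S : VSet n) : Set where
  field
    embed           : Vec Bool k → Vec Bool n
    embed-∈         : ∀ u → embed u ∈ᵥ S
    embed-injective : ∀ u u′ → embed u ≡ embed u′ → u ≡ u′
    embed-adjacent  : ∀ u u′ → hamming u u′ ≡ 1 → hamming (embed u) (embed u′) ≡ 1
    embed-onto      : ∀ v → v ∈ᵥ S → Σ[ u ∈ Vec Bool k ] embed u ≡ v

≅⇒CubeImage : ∀ {n k} (S : VSet n) → Q k ≅ Induced (Q n) (_∈ᵥ S) → CubeImage k S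
≅⇒CubeImage S (f , g , g∘f , f∘g , adj) = record
  { embed           = proj₁ ∘ f
  ; embed-∈         = proj₂ ∘ f
  ; embed-injective = λ u u′ eq → trans (sym (g∘f u)) (trans (cong g (∈ᵥ-Σ-≡ eq)) (g∘f u′))
  ; embed-adjacent  = λ u u′ → Equivalence.to (adj u u′)
  ; embed-onto      = λ v v∈ → g (v , v∈) , cong proj₁ (f∘g (v , v∈))
  }

IsSubcube : ∀ {n} → ℕ → VSet n → Set
IsSubcube {n} k S = Σ[ w ∈ Subcube n ] dim w ≡ k × cubeSet w ≡ S

module FirstCoordinate {n k} {S : VSet (suc n)} (e : CubeImage k S) where
  open CubeImage e

  h : Vec Bool k → Bool
  h = head ∘ embed

  t : Vec Bool k → Vec Bool n
  t = tail ∘ embed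

  embed-≡ : ∀ {u u′} → h u ≡ h u′ → t u ≡ t u′ → u ≡ u′
  embed-≡ {u} {u′} h≡ t≡ =
    embed-injective u u′ (begin
      embed u         ≡⟨ ≡head∷tail (embed u) ⟩
      h u ∷ t u       ≡⟨ cong₂ _∷_ h≡ t≡ ⟩
      h u′ ∷ t u′     ≡⟨ ≡head∷tail (embed u′) ⟨
      embed u′        ∎)

  hamming-embed : ∀ u u′ → hamming (embed u) (embed u′) ≡ hamming (h u ∷ t u) (h u′ ∷ t u′)
  hamming-embed u u′ = cong₂ hamming (≡head∷tail (embed u)) (≡head∷tail (embed u′))

  tails-agree : ∀ u u′ → hamming u u′ ≡ 1 → h u ≢ h u′ → t u ≡ t u′
  tails-agree u u′ adj h≢ = hamming≡0⇒≡ (t u) (t u′) (suc-injective (begin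
    suc (hamming (t u) (t u′))           ≡⟨ hamming-∷-≢ h≢ (t u) (t u′) ⟨
    hamming (h u ∷ t u) (h u′ ∷ t u′)    ≡⟨ hamming-embed u u′ ⟨
    hamming (embed u) (embed u′)         ≡⟨ embed-adjacent u u′ adj ⟩
    1                                    ∎))

  toggle-switch : ∀ i u → h (toggle i u) ≢ h u → h (toggle i u) ≡ not (h u) × t (toggle i u) ≡ t u
  toggle-switch i u sw = ¬-not sw , sym (tails-agree u (toggle i u) (hamming-toggle u i) (sw ∘ sym))

  head-one-switch : AtMostOneSwitch h
  head-one-switch u i j swᵢ swⱼ with toggle-switch i u swᵢ | toggle-switch j u swⱼ
  ... | hᵢ , tᵢ | hⱼ , tⱼ = toggle-injectiveˡ u (embed-≡ (trans hᵢ (sym hⱼ)) (trans tᵢ (sym tⱼ)))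

  restrict : ∀ {k′} b (g : Vec Bool k′ → Vec Bool k) → (∀ v → h (g v) ≡ b) →
             (∀ v v′ → hamming (g v) (g v′) ≡ hamming v v′) →
             (∀ u → h u ≡ b → Σ[ v ∈ Vec Bool k′ ] g v ≡ u) →
             CubeImage k′ (half S b)
  restrict b g hg≡b g-isometry g-onto = record
    { embed           = t ∘ g
    ; embed-∈         = λ v → ∈-half⁻ S b (t (g v)) (subst (_∈ᵥ S) (embed-g v) (embed-∈ (g v)))
    ; embed-injective = λ v v′ eq → hamming≡0⇒≡ v v′ (begin
        hamming v v′           ≡⟨ g-isometry v v′ ⟨
        hamming (g v) (g v′)   ≡⟨ cong (hamming (g v)) (embed-≡ (trans (hg≡b v′) (sym (hg≡b v))) (sym eq)) ⟩
        hamming (g v) (g v)    ≡⟨ hamming-self (g v) ⟩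
        0                      ∎)
    ; embed-adjacent  = λ v v′ adj → begin
        hamming (t (g v)) (t (g v′))              ≡⟨ hamming-∷ b _ _ ⟨
        hamming (b ∷ t (g v)) (b ∷ t (g v′))      ≡⟨ cong₂ hamming (embed-g v) (embed-g v′) ⟨
        hamming (embed (g v)) (embed (g v′))      ≡⟨ embed-adjacent _ _ (trans (g-isometry v v′) adj) ⟩
        1                                         ∎
    ; embed-onto      = onto
    }
    where
    embed-g : ∀ v → embed (g v) ≡ b ∷ t (g v)
    embed-g v = trans (≡head∷tail (embed (g v))) (cong (_∷ t (g v)) (hg≡b v))
    onto : ∀ v → v ∈ᵥ half S b → Σ[ v′ ∈ _ ] t (g v′) ≡ v
    onto v v∈ with embed-onto (b ∷ v) (∈-half⁺ S b v v∈)
    ... | u , eu with g-onto u (cong head eu)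
    ...   | v′ , gv′≡u = v′ , trans (cong t gv′≡u) (cong tail eu)

  half-empty : ∀ b → (∀ u → h u ≡ b) → ∀ v → ¬ v ∈ᵥ half S (not b)
  half-empty b h≡b v v∈ with embed-onto (not b ∷ v) (∈-half⁺ S (not b) v v∈)
  ... | u , eu = not-¬ (h≡b u) (cong head eu)

  module _ {b₀} (c : Fin k) (dictated : ∀ u → h u ≡ b₀ xor lookup u c) where

    dictator-switches : ∀ u → h (toggle c u) ≢ h u
    dictator-switches u eq = not-¬ refl (sym (begin
      not (h u)                      ≡⟨ cong not (dictated u) ⟩
      not (b₀ xor lookup u c)        ≡⟨ not-distribʳ-xor b₀ (lookup u c) ⟩
      b₀ xor not (lookup u c)        ≡⟨ cong (b₀ xor_) (lookup∘updateAt c u) ⟨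
      b₀ xor lookup (toggle c u) c   ≡⟨ dictated (toggle c u) ⟨
      h (toggle c u)                 ≡⟨ eq ⟩
      h u                            ∎))

    half-moves : ∀ b v → v ∈ᵥ half S b → v ∈ᵥ half S (not b)
    half-moves b v v∈ with embed-onto (b ∷ v) (∈-half⁺ S b v v∈)
    ... | u , eu = ∈-half⁻ S (not b) v (subst (_∈ᵥ S) embed-toggle (embed-∈ (toggle c u)))
      where
      embed-toggle : embed (toggle c u) ≡ not b ∷ v
      embed-toggle = begin
        embed (toggle c u)               ≡⟨ ≡head∷tail (embed (toggle c u)) ⟩
        h (toggle c u) ∷ t (toggle c u)  ≡⟨ uncurry (cong₂ _∷_) (toggle-switch c u (dictator-switches u)) ⟩
        not (h u) ∷ t u                  ≡⟨ cong₂ (λ x y → not x ∷ y) (cong head eu) (cong tail eu) ⟩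
        not b ∷ v                        ∎

    halves-equal : half S false ≡ half S true
    halves-equal = VSet-ext _ _ (half-moves false) (half-moves true)

first-coordinate : ∀ {n k} {S : VSet (suc n)} → CubeImage k S →
  (Σ[ b ∈ Bool ] CubeImage k (half S b) × (∀ v → ¬ v ∈ᵥ half S (not b))) ⊎
  (Σ[ k′ ∈ ℕ ] k ≡ suc k′ × CubeImage k′ (half S false) × half S false ≡ half S true)
first-coordinate e with constant-or-dictator (FirstCoordinate.head-one-switch e)
... | inj₁ constant =
  inj₁ (b₀ , restrict b₀ (λ u → u) constant (λ _ _ → refl) (λ u _ → u , refl) , half-empty b₀ constant)
  where
  open FirstCoordinate e
  b₀ : Bool
  b₀ = h (replicate _ false)
first-coordinate {k = zero}    e | inj₂ (() , _)
first-coordinate {k = suc k′} e | inj₂ (c , dictated) =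
  inj₂ (k′ , refl , restrict false ins ins-false (λ v v′ → hamming-insertAt v v′ c b₀) ins-onto ,
        halves-equal {b₀} c dictated)
  where
  open FirstCoordinate e
  b₀ : Bool
  b₀ = h (replicate _ false)
  ins : Vec Bool k′ → Vec Bool (suc k′)
  ins v = insertAt v c b₀
  ins-false : ∀ v → h (ins v) ≡ false
  ins-false v = trans (dictated (ins v)) (trans (cong (b₀ xor_) (insertAt-lookup v c b₀)) (xor-same b₀))
  ins-onto : ∀ u → h u ≡ false → Σ[ v ∈ Vec Bool k′ ] ins v ≡ u
  ins-onto u hu≡false =
    removeAt u c , trans (cong (insertAt (removeAt u c) c) (sym uc≡b₀)) (insertAt-removeAt u c)
    where
    uc≡b₀ : lookup u c ≡ b₀
    uc≡b₀ = begin
      lookup u c                   ≡⟨ cong (_xor lookup u c) (xor-same b₀) ⟨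
      (b₀ xor b₀) xor lookup u c   ≡⟨ xor-assoc b₀ b₀ (lookup u c) ⟩
      b₀ xor (b₀ xor lookup u c)   ≡⟨ cong (b₀ xor_) (trans (sym (dictated u)) hu≡false) ⟩
      b₀ xor false                 ≡⟨ xor-identityʳ b₀ ⟩
      b₀                           ∎

cubeImage⇒subcube : ∀ {n k} (S : VSet n) → CubeImage k S → IsSubcube k S
cubeImage⇒subcube {k = zero} (leaf b) e with CubeImage.embed e [] | CubeImage.embed-∈ e []
... | [] | refl = [] , refl , refl
cubeImage⇒subcube {k = suc k} (leaf b) e with () ←
  CubeImage.embed-injective e (false ∷ replicate k false) (true ∷ replicate k false) (Vec₀-unique _ _)
cubeImage⇒subcube (node l r) e with first-coordinate e
... | inj₁ (false , e′ , empty) with cubeImage⇒subcube l e′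
...   | w , dim≡ , w≡l = fix0 ∷ w , dim≡ , cong₂ node w≡l (sym (empty⇒≡∅ r empty))
cubeImage⇒subcube (node l r) e | inj₁ (true , e′ , empty) with cubeImage⇒subcube r e′
...   | w , dim≡ , w≡r = fix1 ∷ w , dim≡ , cong₂ node (sym (empty⇒≡∅ l empty)) w≡r
cubeImage⇒subcube (node l r) e | inj₂ (k′ , refl , e′ , l≡r) with cubeImage⇒subcube l e′
...   | w , dim≡ , w≡l = free ∷ w , cong suc dim≡ , cong₂ node w≡l (trans w≡l l≡r)

-- Fibonacci strings

-- s is the number of 0s still owed before the next 1: the state of the automaton reading a
-- Fibonacci p-string from left to right.
FibFrom : ℕ → ℕ → ∀ {n} → Vec Bool n → Set
FibFrom p s       []          = ⊤
FibFrom p s       (false ∷ v) = FibFrom p (pred s) v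
FibFrom p zero    (true ∷ v)  = FibFrom p p v
FibFrom p (suc s) (true ∷ v)  = ⊥

LeadingZeros : ℕ → ∀ {n} → Vec Bool n → Set
LeadingZeros s {n} v = (j : Fin n) → lookup v j ≡ true → s ≤ toℕ j

FibString-tail : ∀ {p n b} {v : Vec Bool n} → FibString p (b ∷ v) → FibString p v
FibString-tail {p} fs i j i<j vᵢ vⱼ =
  s<s⁻¹ (subst (_< suc (toℕ j)) (+-suc p (toℕ i)) (fs (suc i) (suc j) (s<s i<j) vᵢ vⱼ))

FibString-head : ∀ {p n} {v : Vec Bool n} → FibString p (true ∷ v) → LeadingZeros p v
FibString-head {p} fs j vⱼ =
  s≤s⁻¹ (subst (_< suc (toℕ j)) (+-identityʳ p) (fs zero (suc j) (s≤s z≤n) refl vⱼ))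

FibString-∷ : ∀ {p n b} {v : Vec Bool n} → FibString p v → (b ≡ true → LeadingZeros p v) →
              FibString p (b ∷ v)
FibString-∷ {p} fs lz zero    (suc j) _   b≡true vⱼ =
  subst (_< suc (toℕ j)) (sym (+-identityʳ p)) (s≤s (lz b≡true j vⱼ))
FibString-∷ {p} fs lz (suc i) (suc j) i<j vᵢ     vⱼ =
  subst (_< suc (toℕ j)) (sym (+-suc p (toℕ i))) (s<s (fs i j (s<s⁻¹ i<j) vᵢ vⱼ))

LeadingZeros-false⁺ : ∀ {s n} {v : Vec Bool n} → LeadingZeros (pred s) v → LeadingZeros s (false ∷ v)
LeadingZeros-false⁺ {zero}  lz (suc j) vⱼ = z≤n
LeadingZeros-false⁺ {suc s} lz (suc j) vⱼ = s≤s (lz j vⱼ)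

LeadingZeros-false⁻ : ∀ {s n} {v : Vec Bool n} → LeadingZeros s (false ∷ v) → LeadingZeros (pred s) v
LeadingZeros-false⁻ lz j vⱼ = pred-mono-≤ (lz (suc j) vⱼ)

FibFrom⇒ : ∀ p s {n} (v : Vec Bool n) → FibFrom p s v → FibString p v × LeadingZeros s v
FibFrom⇒ p s       []          _  = (λ ()) , (λ ())
FibFrom⇒ p s       (false ∷ v) ff with FibFrom⇒ p (pred s) v ff
... | fs , lz = FibString-∷ fs (λ ()) , LeadingZeros-false⁺ lz
FibFrom⇒ p zero    (true ∷ v)  ff with FibFrom⇒ p p v ff
... | fs , lz = FibString-∷ fs (λ _ → lz) , (λ _ _ → z≤n)

⇒FibFrom : ∀ p s {n} (v : Vec Bool n) → FibString p v → LeadingZeros s v → FibFrom p s v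
⇒FibFrom p s       []          _  _  = tt
⇒FibFrom p s       (false ∷ v) fs lz = ⇒FibFrom p (pred s) v (FibString-tail fs) (LeadingZeros-false⁻ lz)
⇒FibFrom p zero    (true ∷ v)  fs lz = ⇒FibFrom p p v (FibString-tail fs) (FibString-head fs)
⇒FibFrom p (suc s) (true ∷ v)  fs lz with () ← lz zero refl

FibString⇔FibFrom : ∀ p {n} (v : Vec Bool n) → FibString p v ⇔ FibFrom p 0 v
FibString⇔FibFrom p v = mk⇔ (λ fs → ⇒FibFrom p 0 v fs (λ _ _ → z≤n)) (proj₁ ∘ FibFrom⇒ p 0 v)

FibString-antitone : ∀ {p n} {v v′ : Vec Bool n} → (∀ i → lookup v i ≡ true → lookup v′ i ≡ true) →
                     FibString p v′ → FibString p v
FibString-antitone v≤v′ fs i j i<j vᵢ vⱼ = fs i j i<j (v≤v′ i vᵢ) (v≤v′ j vⱼ)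

-- Counting Fibonacci subcubes

fibSubcubes : (p n k s : ℕ) → List (Subcube n)
fibSubcubes p zero    zero    s       = [] ∷ []
fibSubcubes p zero    (suc k) s       = []
fibSubcubes p (suc n) k       (suc s) = map (fix0 ∷_) (fibSubcubes p n k s)
fibSubcubes p (suc n) zero    zero    =
  map (fix0 ∷_) (fibSubcubes p n 0 0) ++ map (fix1 ∷_) (fibSubcubes p n 0 p)
fibSubcubes p (suc n) (suc k) zero    =
  map (fix0 ∷_) (fibSubcubes p n (suc k) 0) ++
  map (fix1 ∷_) (fibSubcubes p n (suc k) p) ++
  map (free ∷_) (fibSubcubes p n k p)

fibSubcubes-sound : ∀ p n k s → All (λ w → dim w ≡ k × FibFrom p s (top w)) (fibSubcubes p n k s)
fibSubcubes-sound p zero    zero    s       = (refl , tt) ∷ []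
fibSubcubes-sound p zero    (suc k) s       = []
fibSubcubes-sound p (suc n) k       (suc s) = All.map⁺ (fibSubcubes-sound p n k s)
fibSubcubes-sound p (suc n) zero    zero    =
  All.++⁺ (All.map⁺ (fibSubcubes-sound p n 0 0)) (All.map⁺ (fibSubcubes-sound p n 0 p))
fibSubcubes-sound p (suc n) (suc k) zero    =
  All.++⁺ (All.map⁺ (fibSubcubes-sound p n (suc k) 0))
          (All.++⁺ (All.map⁺ (fibSubcubes-sound p n (suc k) p))
                   (All.map⁺ (All.map (Product.map₁ (cong suc)) (fibSubcubes-sound p n k p))))

fibSubcubes-complete : ∀ p n k s (w : Subcube n) → dim w ≡ k → FibFrom p s (top w) →
                       w ∈ fibSubcubes p n k s
fibSubcubes-complete p zero    zero    s       []         _    _  = here refl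
fibSubcubes-complete p (suc n) k       (suc s) (fix0 ∷ w) dim≡ ff =
  ∈-map⁺ (fix0 ∷_) (fibSubcubes-complete p n k s w dim≡ ff)
fibSubcubes-complete p (suc n) zero    zero    (fix0 ∷ w) dim≡ ff =
  ∈-++⁺ˡ (∈-map⁺ (fix0 ∷_) (fibSubcubes-complete p n 0 0 w dim≡ ff))
fibSubcubes-complete p (suc n) zero    zero    (fix1 ∷ w) dim≡ ff =
  ∈-++⁺ʳ (map (fix0 ∷_) (fibSubcubes p n 0 0))
    (∈-map⁺ (fix1 ∷_) (fibSubcubes-complete p n 0 p w dim≡ ff))
fibSubcubes-complete p (suc n) (suc k) zero    (fix0 ∷ w) dim≡ ff =
  ∈-++⁺ˡ (∈-map⁺ (fix0 ∷_) (fibSubcubes-complete p n (suc k) 0 w dim≡ ff))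
fibSubcubes-complete p (suc n) (suc k) zero    (fix1 ∷ w) dim≡ ff =
  ∈-++⁺ʳ (map (fix0 ∷_) (fibSubcubes p n (suc k) 0))
    (∈-++⁺ˡ (∈-map⁺ (fix1 ∷_) (fibSubcubes-complete p n (suc k) p w dim≡ ff)))
fibSubcubes-complete p (suc n) (suc k) zero    (free ∷ w) dim≡ ff =
  ∈-++⁺ʳ (map (fix0 ∷_) (fibSubcubes p n (suc k) 0)) (∈-++⁺ʳ (map (fix1 ∷_) (fibSubcubes p n (suc k) p))
    (∈-map⁺ (free ∷_) (fibSubcubes-complete p n k p w (suc-injective dim≡) ff)))

Unique-map-∷ : ∀ {A : Set} {n} (a : A) {xs : List (Vec A n)} → Unique xs → Unique (map (a ∷_) xs)
Unique-map-∷ a = Unique.map⁺ ∷-injectiveʳ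

Disjoint-map-∷ : ∀ {A : Set} {n} {a b : A} → a ≢ b → (xs ys : List (Vec A n)) →
                 Disjoint (map (a ∷_) xs) (map (b ∷_) ys)
Disjoint-map-∷ {a = a} {b} a≢b xs ys (∈xs , ∈ys) with ∈-map⁻ (a ∷_) ∈xs | ∈-map⁻ (b ∷_) ∈ys
... | _ , _ , eq | _ , _ , eq′ = a≢b (∷-injectiveˡ (trans (sym eq) eq′))

Disjoint-++ʳ : ∀ {A : Set} (xs ys zs : List A) → Disjoint xs ys → Disjoint xs zs →
               Disjoint xs (ys ++ zs)
Disjoint-++ʳ xs ys zs xs#ys xs#zs (∈xs , ∈ys++zs) with ∈-++⁻ ys ∈ys++zs
... | inj₁ ∈ys = xs#ys (∈xs , ∈ys)
... | inj₂ ∈zs = xs#zs (∈xs , ∈zs)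

fibSubcubes-unique : ∀ p n k s → Unique (fibSubcubes p n k s)
fibSubcubes-unique p zero    zero    s       = [] ∷ []
fibSubcubes-unique p zero    (suc k) s       = []
fibSubcubes-unique p (suc n) k       (suc s) = Unique-map-∷ fix0 (fibSubcubes-unique p n k s)
fibSubcubes-unique p (suc n) zero    zero    =
  Unique.++⁺ (Unique-map-∷ fix0 (fibSubcubes-unique p n 0 0))
             (Unique-map-∷ fix1 (fibSubcubes-unique p n 0 p))
             (Disjoint-map-∷ (λ ()) _ _)
fibSubcubes-unique p (suc n) (suc k) zero    =
  Unique.++⁺ (Unique-map-∷ fix0 (fibSubcubes-unique p n (suc k) 0))
             (Unique.++⁺ (Unique-map-∷ fix1 (fibSubcubes-unique p n (suc k) p))
                         (Unique-map-∷ free (fibSubcubes-unique p n k p))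
                         (Disjoint-map-∷ (λ ()) _ _))
             (Disjoint-++ʳ _ (map (fix1 ∷_) (fibSubcubes p n (suc k) p)) (map (free ∷_) (fibSubcubes p n k p))
                           (Disjoint-map-∷ (λ ()) _ _) (Disjoint-map-∷ (λ ()) _ _))

∸-∸-comm : ∀ m x y → m ∸ x ∸ y ≡ m ∸ y ∸ x
∸-∸-comm m x y = trans (∸-+-assoc m x y) (trans (cong (m ∸_) (+-comm x y)) (sym (∸-+-assoc m y x)))

module _ {p} (1≤p : 1 ≤ p) where

  F⋆^-recurrence : ∀ r m →
    (F p ⋆^ suc r) (suc m) ≡ (F p ⋆^ suc r) m + (F p ⋆^ r) m + (F p ⋆^ suc r) (m ∸ p)
  F⋆^-recurrence r = ⋆-recurrence p (F p) (F p ⋆^ r) refl (F-suc 1≤p)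

  F⋆^-≤1 : ∀ r m → m ≤ 1 → (F p ⋆^ suc (suc r)) m ≡ 0
  F⋆^-≤1 r zero          _        = refl
  F⋆^-≤1 r (suc zero)    _        = *-zeroʳ (F p 1)
  F⋆^-≤1 r (suc (suc m)) (s≤s ())

  F⋆^-recurrence-∸ : ∀ r m b → (F p ⋆^ suc (suc r)) (suc m ∸ b) ≡
    (F p ⋆^ suc (suc r)) (m ∸ b) + (F p ⋆^ suc r) (m ∸ b) + (F p ⋆^ suc (suc r)) (m ∸ b ∸ p)
  F⋆^-recurrence-∸ r m b with b ≤? m
  ... | yes b≤m =
    trans (cong (F p ⋆^ suc (suc r)) (+-∸-assoc 1 b≤m)) (F⋆^-recurrence (suc r) (m ∸ b))
  ... | no  b≰m rewrite m≤n⇒m∸n≡0 (≰⇒> b≰m) | m≤n⇒m∸n≡0 (<⇒≤ (≰⇒> b≰m)) | 0∸n≡0 p = refl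

  -- Written with suc (n + p) ∸ s so that the case s ↦ suc s holds definitionally.
  length-fibSubcubes : ∀ n k s → s ≤ p →
                       length (fibSubcubes p n k s) ≡ (F p ⋆^ suc k) ((suc (n + p) ∸ s) ∸ k * p)
  length-fibSubcubes zero    zero    s s≤p = sym (begin
    (F p ⋆ δ) (suc p ∸ s)   ≡⟨ ⋆-identityʳ (F p) (suc p ∸ s) ⟩
    F p (suc p ∸ s)         ≡⟨ cong (F p) (+-∸-assoc 1 s≤p) ⟩
    F p (suc (p ∸ s))       ≡⟨ F-initial 1≤p (p ∸ s) (m∸n≤m p s) ⟩
    1                       ∎)
  length-fibSubcubes zero    (suc k) s s≤p =
    sym (F⋆^-≤1 k _ (≤-trans (∸-mono (m∸n≤m (suc p) s) (m≤m+n p (k * p)))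
                             (≤-reflexive (m+n∸n≡m 1 p))))
  length-fibSubcubes (suc n) k       (suc s) s≤p =
    trans (length-map (fix0 ∷_) (fibSubcubes p n k s))
          (length-fibSubcubes n k s (≤-trans (n≤1+n s) s≤p))
  length-fibSubcubes (suc n) zero    zero    _   = begin
    length (map (fix0 ∷_) (fibSubcubes p n 0 0) ++ map (fix1 ∷_) (fibSubcubes p n 0 p))
      ≡⟨ length-++ (map (fix0 ∷_) (fibSubcubes p n 0 0)) ⟩
    length (map (fix0 ∷_) (fibSubcubes p n 0 0)) + length (map (fix1 ∷_) (fibSubcubes p n 0 p))
      ≡⟨ cong₂ _+_ (trans (length-map (fix0 ∷_) (fibSubcubes p n 0 0)) (length-fibSubcubes n 0 0 z≤n))
                   (trans (length-map (fix1 ∷_) (fibSubcubes p n 0 p)) (length-fibSubcubes n 0 p ≤-refl)) ⟩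
    G₁ m + G₁ (m ∸ p)
      ≡⟨ cong (_+ G₁ (m ∸ p)) (+-identityʳ (G₁ m)) ⟨
    G₁ m + 0 + G₁ (m ∸ p)
      ≡⟨ F⋆^-recurrence 0 m ⟨
    G₁ (suc m) ∎
    where
    m : ℕ
    m = suc (n + p)
    G₁ : ℕ → ℕ
    G₁ = F p ⋆^ 1
  length-fibSubcubes (suc n) (suc k) zero    _   = begin
    length (map (fix0 ∷_) A ++ map (fix1 ∷_) B ++ map (free ∷_) C)
      ≡⟨ length-++ (map (fix0 ∷_) A) ⟩
    length (map (fix0 ∷_) A) + length (map (fix1 ∷_) B ++ map (free ∷_) C)
      ≡⟨ cong (length (map (fix0 ∷_) A) +_) (length-++ (map (fix1 ∷_) B)) ⟩
    length (map (fix0 ∷_) A) + (length (map (fix1 ∷_) B) + length (map (free ∷_) C))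
      ≡⟨ cong₂ _+_ (trans (length-map (fix0 ∷_) A) (length-fibSubcubes n (suc k) 0 z≤n))
                   (cong₂ _+_ (trans (length-map (fix1 ∷_) B) (length-fibSubcubes n (suc k) p ≤-refl))
                              (trans (length-map (free ∷_) C) (length-fibSubcubes n k p ≤-refl))) ⟩
    G₂ (m ∸ b) + (G₂ (m ∸ p ∸ b) + G₁ (m ∸ p ∸ k * p))
      ≡⟨ cong₂ (λ x y → G₂ (m ∸ b) + (G₂ x + G₁ y)) (∸-∸-comm m p b) (∸-+-assoc m p (k * p)) ⟩
    G₂ (m ∸ b) + (G₂ (m ∸ b ∸ p) + G₁ (m ∸ b))
      ≡⟨ +-rearrange (G₂ (m ∸ b)) (G₂ (m ∸ b ∸ p)) (G₁ (m ∸ b)) ⟩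
    G₂ (m ∸ b) + G₁ (m ∸ b) + G₂ (m ∸ b ∸ p)
      ≡⟨ F⋆^-recurrence-∸ k m b ⟨
    G₂ (suc m ∸ b) ∎
    where
    A B C : List (Subcube n)
    A = fibSubcubes p n (suc k) 0
    B = fibSubcubes p n (suc k) p
    C = fibSubcubes p n k p
    m b : ℕ
    m = suc (n + p)
    b = suc k * p
    G₁ G₂ : ℕ → ℕ
    G₁ = F p ⋆^ suc k
    G₂ = F p ⋆^ suc (suc k)

subcube⇒InducedCubeOf : ∀ {p n k} (w : Subcube n) → dim w ≡ k → FibString p (top w) →
                        InducedCubeOf p n k (cubeSet w)
subcube⇒InducedCubeOf w refl fs =
  (λ v v∈ → FibString-antitone {v = v} {top w} (∈cubeSet⇒≤top w v v∈) fs) , Q≅cubeSet w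

InducedCubeOf⇒subcube : ∀ {p n k} (S : VSet n) → InducedCubeOf p n k S →
                        Σ[ w ∈ Subcube n ] (dim w ≡ k × FibString p (top w)) × cubeSet w ≡ S
InducedCubeOf⇒subcube S (fib , iso) with cubeImage⇒subcube S (≅⇒CubeImage S iso)
... | w , dim≡ , w≡S = w , (dim≡ , fib (top w) (subst (top w ∈ᵥ_) w≡S (top-∈ w))) , w≡S

∈-cubeSets⇔InducedCubeOf : ∀ p n k S → S ∈ map cubeSet (fibSubcubes p n k 0) ⇔ InducedCubeOf p n k S
∈-cubeSets⇔InducedCubeOf p n k S = mk⇔ to from
  where
  to : S ∈ map cubeSet (fibSubcubes p n k 0) → InducedCubeOf p n k S
  to S∈ with ∈-map⁻ cubeSet S∈
  ... | w , w∈ , refl with All.lookup (fibSubcubes-sound p n k 0) w∈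
  ...   | dim≡ , ff = subcube⇒InducedCubeOf w dim≡ (Equivalence.from (FibString⇔FibFrom p (top w)) ff)
  from : InducedCubeOf p n k S → S ∈ map cubeSet (fibSubcubes p n k 0)
  from ic with InducedCubeOf⇒subcube S ic
  ... | w , (dim≡ , fs) , refl =
    ∈-map⁺ cubeSet (fibSubcubes-complete p n k 0 w dim≡ (Equivalence.to (FibString⇔FibFrom p (top w)) fs))

theorem4p2 : (p n k : ℕ) → 1 ≤ p →
    HasExactly (InducedCubeOf p n k) (fibCompSum p k ((n + p + 1) ∸ (k * p)))
theorem4p2 p n k 1≤p =
  map cubeSet (fibSubcubes p n k 0) ,
  Unique.map⁺ (cubeSet-injective _ _) (fibSubcubes-unique p n k 0) ,
  ∈-cubeSets⇔InducedCubeOf p n k ,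
  (begin
    length (map cubeSet (fibSubcubes p n k 0))   ≡⟨ length-map cubeSet (fibSubcubes p n k 0) ⟩
    length (fibSubcubes p n k 0)                 ≡⟨ length-fibSubcubes 1≤p n k 0 z≤n ⟩
    (F p ⋆^ suc k) (suc (n + p) ∸ k * p)          ≡⟨ cong (λ m → (F p ⋆^ suc k) (m ∸ k * p)) (+-comm (n + p) 1) ⟨
    (F p ⋆^ suc k) (n + p + 1 ∸ k * p)            ≡⟨ compositions-⋆^ (F p) (suc k) (n + p + 1 ∸ k * p) ⟨
    fibCompSum p k (n + p + 1 ∸ k * p)            ∎)
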